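{- For every context $\Gamma$ and formula $C$ there exists a finitary term $N_{\Gamma\Rightarrow C}\in\overline{\lambda}^{gfp}_{\Sigma}$ with no free occurrences of fixpoint variables such that $[\![N_{\Gamma\Rightarrow C}]\!]=\mathcal{S}(\Gamma\Rightarrow C)$.
   Context: Formulas are built from atoms by implication $\supset$ (associating to the right); contexts are finite lists of declarations with distinct variables; $|\Gamma|$ is the set of formulas declared in $\Gamma$; $\Gamma\le\Gamma'$ means $\Gamma\subseteq\Gamma'$ and $|\Gamma|=|\Gamma'|$. A sequent $\sigma=(\Gamma\Rightarrow p)$ pairs a context with an atom; $(\Gamma\Rightarrow p)\le(\Gamma'\Rightarrow p')$ means $\Gamma\le\Gamma'$ and $p=p'$. Böhm forests and elimination alternatives are the possibly infinite expressions generated coinductively by $N::=_{co}\lambda x^A.N\mid E_1+\cdots+E_n$, $E::=_{co}x\langle N_1,\dots,N_k\rangle$ ($n,k\ge0$); equality of Böhm forests is coinductive (bisimilarity) with sums of alternatives treated as sets ($+$ associative, commutative, idempotent, empty sum $\mathbb{O}$ neutral). The solution space is defined corecursively by $\mathcal{S}(\Gamma\Rightarrow A\supset B)=\lambda x^A.\mathcal{S}(\Gamma,x:A\Rightarrow B)$ ($x$ fresh) and $\mathcal{S}(\Gamma\Rightarrow p)=\sum_{(y:B_1\supset\cdots\supset B_k\supset p)\in\Gamma}y\langle\mathcal{S}(\Gamma\Rightarrow B_1),\dots,\mathcal{S}(\Gamma\Rightarrow B_k)\rangle$ for $p$ an atom. For $\Gamma\le\Gamma'$, co-contraction $[\Gamma'/\Gamma]$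 on Böhm forests is defined by corecursion: $[\Gamma'/\Gamma](\lambda x^A.N)=\lambda x^A.[\Gamma',x:A/\Gamma,x:A]N$; $[\Gamma'/\Gamma]\sum_iE_i=\sum_i[\Gamma'/\Gamma]E_i$; $[\Gamma'/\Gamma](z\langle N_1,\dots,N_k\rangle)=z\langle[\Gamma'/\Gamma]N_1,\dots\rangle$ if $z$ is not declared in $\Gamma$, and $=\sum_{(w:\Gamma(z))\in\Gamma'}w\langle[\Gamma'/\Gamma]N_1,\dots,[\Gamma'/\Gamma]N_k\rangle$ if $z$ is declared in $\Gamma$ with formula $\Gamma(z)$; for sequents, $[(\Gamma'\Rightarrow p)/(\Gamma\Rightarrow p)]:=[\Gamma'/\Gamma]$. The finitary calculus $\overline{\lambda}^{gfp}_{\Sigma}$ has inductively defined terms $N::=\lambda x^A.N\mid\mathrm{gfp}\,X^{\sigma}.(E_1+\cdots+E_n)\mid X^{\sigma}$ and elimination alternatives $E::=x\langle N_1,\dots,N_k\rangle$, where fixpoint variables $X$ (bound by $\mathrm{gfp}$) are annotated with sequents $\sigma$. An environment $\xi$ assigns Böhm forests to annotated fixpoint variables $X^{\sigma}$, with no $X$ occurring with two different annotations in its domain. The interpretation is: $[\![X^{\sigma'}]\!]_\xi=[\sigma'/\sigma]\,\xi(X^{\sigma})$ if $X^{\sigma}$ is in the domain of $\xi$ and $\sigma\le\sigma'$ (some fixed default value otherwise); $[\![\lambda x^A.N]\!]_\xi=\lambda x^A.[\![N]\!]_\xi$; $[\![x\langle N_1,\dots,N_k\rangle]\!]_\xi=x\langle[\![N_1]\!]_\xi,\dots,[\![N_k]\!]_\xi\rangle$;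 $[\![\mathrm{gfp}\,X^{\sigma}.\sum_iE_i]\!]_\xi$ is the unique Böhm forest $N$ with $N=\sum_i[\![E_i]\!]_{\xi\cup[X^{\sigma}\mapsto N]}$ (the binding of $X^\sigma$ replacing any previous binding of $X$). For a term without free fixpoint variables, $[\![N]\!]$ denotes its interpretation (independent of the environment). -}

module Defs where

open import Data.Nat using (ℕ; zero; suc)
import Data.Nat as Nat
open import Data.List using (List; []; _∷_; _++_; _∷ʳ_; map; concatMap)
open import Data.Unit using (⊤; tt)
open import Data.List.Membership.Propositional using (_∈_)
open import Data.List.Relation.Unary.Any using (Any)
open import Data.List.Relation.Unary.All using (All)
open import Data.List.Relation.Binary.Pointwise using (Pointwise)
open import Data.Maybe using (Maybe; just; nothing)
open import Data.Product using (Σ; ∃; _×_; _,_)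
open import Relation.Binary.PropositionalEquality using (_≡_; refl; cong; cong₂)
open import Relation.Nullary using (Dec; yes; no; ¬_)

infixr 6 _⊃_
data Formula : Set where
  atom : ℕ → Formula
  _⊃_  : Formula → Formula → Formula

_≟F_ : (A B : Formula) → Dec (A ≡ B)
atom p ≟F atom q with p Nat.≟ q
... | yes refl = yes refl
... | no p≢q = no λ { refl → p≢q refl }
atom p ≟F (B ⊃ B') = no λ ()
(A ⊃ A') ≟F atom q = no λ ()
(A ⊃ A') ≟F (B ⊃ B') with A ≟F B | A' ≟F B'
... | yes refl | yes refl = yes refl
... | no ne | _ = no λ { refl → ne refl }
... | yes _ | no ne = no λ { refl → ne refl }

args : Formula → List Formula
args (atom p) = []
args (A ⊃ B) = A ∷ args B

target : Formula → ℕ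
target (atom p) = p
target (A ⊃ B) = target B

-- Variables are de Bruijn LEVELS: the variable declared at
-- position i of the context (counting from the left, from 0) is named i.
-- Thus a context is a list of formulas, its variables are automatically
-- distinct, and the fresh variable for extending Γ is  length Γ.
-- The declaration set of Γ is {(i , Γ[i])}.

Context : Set
Context = List Formula

lookupCtx : Context → ℕ → Maybe Formula
lookupCtx [] _ = nothing
lookupCtx (A ∷ Γ) zero = just A
lookupCtx (A ∷ Γ) (suc i) = lookupCtx Γ i

-- Γ ≤ Γ' : declarations of Γ ⊆ declarations of Γ' (with level names this is
-- exactly: Γ is a prefix of Γ'), and |Γ| = |Γ'| as sets of formulas.
_≤C_ : Context → Context → Set
Γ ≤C Γ' = (∃ λ Δ → Γ' ≡ Γ ++ Δ) × (∀ A → (A ∈ Γ → A ∈ Γ') × (A ∈ Γ' → A ∈ Γ))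

record Sequent : Set where
  constructor _⇒_
  field
    ctx  : Context
    goal : ℕ
open Sequent public

_≤S_ : Sequent → Sequent → Set
σ ≤S σ' = (ctx σ ≤C ctx σ') × (goal σ ≡ goal σ')

-- Böhm forests:  N ::=_co λx^A.N | E₁+⋯+Eₙ ,  E ::=_co x⟨N₁,…,Nₖ⟩
-- (the variable bound by λ at context length n is the level n).

data NodeF (S : Set) : Set where
  lamF : Formula → S → NodeF S
  sumF : List (ℕ × List S) → NodeF S

record Forest : Set₁ where
  field
    St   : Set
    nx   : St → NodeF St
    root : St
open Forest public

at : (F : Forest) → St F → Forest
at F s = record { St = St F ; nx = nx F ; root = s }

ElimRel : {S T : Set} (R : S → T → Set) → ℕ × List S → ℕ × List T → Set
ElimRel R (x , ss) (y , ts) = x ≡ y × Pointwise R ss ts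

data NodeRel {S T : Set} (R : S → T → Set) : NodeF S → NodeF T → Set where
  lam≈ : ∀ {A s t} → R s t → NodeRel R (lamF A s) (lamF A t)
  sum≈ : ∀ {Es Fs} →
         (∀ {e} → e ∈ Es → Any (λ f → ElimRel R e f) Fs) →
         (∀ {f} → f ∈ Fs → Any (λ e → ElimRel R e f) Es) →
         NodeRel R (sumF Es) (sumF Fs)

IsBisim : (F G : Forest) → (St F → St G → Set) → Set
IsBisim F G R = ∀ s t → R s t → NodeRel R (nx F s) (nx G t)

_≈_ : Forest → Forest → Set₁
F ≈ G = Σ (St F → St G → Set) λ R → IsBisim F G R × R (root F) (root G)

data Node : Set₁ where
  lam : Formula → Forest → Node
  sum : List (ℕ × List Forest) → Node

_≈node_ : Forest → Node → Set₁
F ≈node lam A G = Σ (St F) λ s → (nx F (root F) ≡ lamF A s) × (at F s ≈ G)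
F ≈node sum Gs = Σ (List (ℕ × List (St F))) λ Es →
  (nx F (root F) ≡ sumF Es) ×
  (∀ {e} → e ∈ Es → Any (λ g → Rel e g) Gs) ×
  (∀ {g} → g ∈ Gs → Any (λ e → Rel e g) Es)
  where
  Rel : ℕ × List (St F) → ℕ × List Forest → Set₁
  Rel (x , ss) (y , Hs) = x ≡ y × Pointwise (λ s H → at F s ≈ H) ss Hs

𝕆 : Forest
𝕆 = record { St = ⊤ ; nx = λ _ → sumF [] ; root = tt }

altsStep : ∀ {P : Set} {X : Set} → Dec P → X → List X → List X
altsStep (yes _) e es = e ∷ es
altsStep (no _) e es = es

-- alternatives y⟨(Γ,B₁),…,(Γ,Bₖ)⟩ for declarations (y : B₁⊃⋯⊃Bₖ⊃p) ∈ Γ;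
-- the last argument is the remaining suffix of Γ, starting at level i
alts : Context → ℕ → ℕ → Context → List (ℕ × List (Context × Formula))
alts Γ p i [] = []
alts Γ p i (B ∷ Δ) =
  altsStep (target B Nat.≟ p) (i , map (λ Bj → (Γ , Bj)) (args B)) (alts Γ p (suc i) Δ)

𝒮step : Context × Formula → NodeF (Context × Formula)
𝒮step (Γ , A ⊃ B) = lamF A (Γ ∷ʳ A , B)          -- bound variable: fresh level length Γ
𝒮step (Γ , atom p) = sumF (alts Γ p 0 Γ)

𝒮 : Context → Formula → Forest
𝒮 Γ C = record { St = Context × Formula ; nx = 𝒮step ; root = (Γ , C) }

varsWith : Formula → ℕ → Context → List ℕ
varsWith A i [] = []
varsWith A i (B ∷ Γ) = altsStep (A ≟F B) i (varsWith A (suc i) Γ)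

ccHead : {S : Set} → Context → Context → ℕ → List S → List (ℕ × List S)
ccHead Γ Γ' z ms with lookupCtx Γ z
... | just A  = map (λ w → (w , ms)) (varsWith A 0 Γ')
... | nothing = (z , ms) ∷ []

ccStep : {S : Set} → (S → NodeF S) → S × Context × Context → NodeF (S × Context × Context)
ccStep nxt (s , Γ , Γ') with nxt s
... | lamF A s' = lamF A (s' , Γ ∷ʳ A , Γ' ∷ʳ A)
... | sumF Es = sumF (concatMap (λ { (z , ss) → ccHead Γ Γ' z (map (λ s'' → (s'' , Γ , Γ')) ss) }) Es)

cc : Context → Context → Forest → Forest
cc Γ Γ' F = record { St = St F × Context × Context ; nx = ccStep (nx F) ; root = (root F , Γ , Γ') }

ccS : Sequent → Sequent → Forest → Forest
ccS σ σ' = cc (ctx σ) (ctx σ')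

mutual
  data Tm : Set where
    lamT : Formula → Tm → Tm
    gfp  : ℕ → Sequent → List ElimT → Tm
    fvar : ℕ → Sequent → Tm

  data ElimT : Set where
    appT : ℕ → List Tm → ElimT

mutual
  data ClosedIn (Xs : List ℕ) : Tm → Set where
    lamC : ∀ {A N} → ClosedIn Xs N → ClosedIn Xs (lamT A N)
    gfpC : ∀ {X σ Es} → All (ClosedInE (X ∷ Xs)) Es → ClosedIn Xs (gfp X σ Es)
    varC : ∀ {X σ} → X ∈ Xs → ClosedIn Xs (fvar X σ)

  data ClosedInE (Xs : List ℕ) : ElimT → Set where
    appC : ∀ {x Ns} → All (ClosedIn Xs) Ns → ClosedInE Xs (appT x Ns)

Closed : Tm → Set
Closed = ClosedIn []

-- Environments: bindings X^σ ↦ forest; a new binding of X shadows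
-- (replaces) any previous binding of X, so each X has one annotation.

Env : Set₁
Env = List (ℕ × Sequent × Forest)

lookupEnv : Env → ℕ → Maybe (Sequent × Forest)
lookupEnv [] X = nothing
lookupEnv ((Y , σ , F) ∷ ξ) X with X Nat.≟ Y
... | yes _ = just (σ , F)
... | no _ = lookupEnv ξ X

-- Interp ξ N F :  F = [[N]]_ξ   (F determined up to bisimilarity; the
-- gfp clause says F is a solution of  F = Σᵢ [[Eᵢ]]_{ξ ∪ [X^σ ↦ F]}).
-- The fixed default value for unbound / non-≤ fixpoint variables is 𝕆.
mutual
  data Interp (ξ : Env) : Tm → Forest → Set₁ where
    var-bound : ∀ {X σ σ' G F} → lookupEnv ξ X ≡ just (σ , G) → σ ≤S σ' →
                F ≈ ccS σ σ' G → Interp ξ (fvar X σ') F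
    var-default : ∀ {X σ' F} → (∀ σ G → lookupEnv ξ X ≡ just (σ , G) → ¬ (σ ≤S σ')) →
                F ≈ 𝕆 → Interp ξ (fvar X σ') F
    lam-i : ∀ {A N F F'} → Interp ξ N F' → F ≈node lam A F' → Interp ξ (lamT A N) F
    gfp-i : ∀ {X σ Es F} (Fs : List (ℕ × List Forest)) →
            Pointwise (InterpE ((X , σ , F) ∷ ξ)) Es Fs →
            F ≈node sum Fs → Interp ξ (gfp X σ Es) F

  data InterpE (ξ : Env) : ElimT → ℕ × List Forest → Set₁ where
    app-i : ∀ {x Ns Gs} → Pointwise (Interp ξ) Ns Gs → InterpE ξ (appT x Ns) (x , Gs)

_⟦⟧≈_ : Tm → Forest → Set₁
N ⟦⟧≈ G = Interp [] N G × (∀ F → Interp [] N F → F ≈ G)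

-- An atomic sequent Γ ⇒ p of the solution space is turned into a fixpoint
-- gfp X_p^(Γ⇒p), except when an enclosing fixpoint for p was opened at a context
-- Γq ≤ Γ, where it becomes the variable X_p^(Γ⇒p). This unfolding is finite:
-- contexts only collect subformulas of the initial sequent, and as long as |Γ|
-- does not grow every atom opens at most one fixpoint. The term denotes
-- S(Γ ⇒ C) because co-contraction [Γ/Γq] maps S(Γq ⇒ p) to S(Γ ⇒ p) when
-- |Γq| = |Γ|. Nothing else solves its fixpoint equations: every gfp body starts
-- with eliminations, so agreement with S up to depth m propagates to depth m+1,
-- and the alternatives of S are determined by their heads.

module Submission where

open import Defs
open import Data.Empty using (⊥-elim)
open import Data.List using (List; []; _∷_; _++_; _∷ʳ_; map; concatMap)
import Data.List.Properties as List
open import Data.List.Membership.Propositional using (_∈_; _∉_; find; lose)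
open import Data.List.Membership.Propositional.Properties
  using (∈-map⁺; ∈-map⁻; ∈-++⁺ˡ; ∈-++⁺ʳ; ∈-++⁻; ∈-concatMap⁺; ∈-concatMap⁻)
import Data.List.Membership.DecPropositional as DecMembership
open import Data.List.Relation.Binary.Pointwise as Pointwise using (Pointwise; []; _∷_)
open import Data.List.Relation.Binary.Subset.Propositional using (_⊆_)
open import Data.List.Relation.Unary.All as All using (All; []; _∷_)
open import Data.List.Relation.Unary.Any as Any using (Any; here; there)
open import Data.Maybe using (just)
open import Data.Nat using (ℕ; zero; suc; _+_; _≤_; _<_; z≤n; s≤s)
import Data.Nat as ℕ
import Data.Nat.Properties as ℕ
open import Data.Product using (Σ; ∃; ∃₂; _×_; _,_; proj₁; proj₂; uncurry)
open import Data.Sum using (_⊎_; inj₁; inj₂)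
open import Data.Unit using (⊤; tt)
open import Function using (_∘_)
open import Relation.Binary.Definitions using (DecidableEquality)
open import Relation.Binary.PropositionalEquality using (_≡_; _≢_; refl; sym; trans; cong; subst)
open import Relation.Nullary using (Dec; yes; no; ¬_; ¬?)

Pointwise-∈ˡ : ∀ {a b ℓ} {A : Set a} {B : Set b} {R : A → B → Set ℓ} {xs ys x} →
  Pointwise R xs ys → x ∈ xs → ∃ λ y → y ∈ ys × R x y
Pointwise-∈ˡ (r ∷ rs) (here refl) = _ , here refl , r
Pointwise-∈ˡ (r ∷ rs) (there x∈) with Pointwise-∈ˡ rs x∈
... | y , y∈ , r' = y , there y∈ , r'

Pointwise-∈ʳ : ∀ {a b ℓ} {A : Set a} {B : Set b} {R : A → B → Set ℓ} {xs ys y} →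
  Pointwise R xs ys → y ∈ ys → ∃ λ x → x ∈ xs × R x y
Pointwise-∈ʳ rs y∈ = Pointwise-∈ˡ (Pointwise.symmetric (λ r → r) rs) y∈

Pointwise-∀ : ∀ {A B : Set} {R : ℕ → A → B → Set} {xs ys} →
  (∀ m → Pointwise (R m) xs ys) → Pointwise (λ x y → ∀ m → R m x y) xs ys
Pointwise-∀ {R = R} h = go (h 0) h
  where
  go : ∀ {xs ys} → Pointwise (R 0) xs ys → (∀ m → Pointwise (R m) xs ys) →
       Pointwise (λ x y → ∀ m → R m x y) xs ys
  go [] _ = []
  go (_ ∷ rs) h = (λ m → Pointwise.head (h m)) ∷ go rs (λ m → Pointwise.tail (h m))

∈-∷ʳ⁻ : ∀ {A : Set} (xs : List A) {x y} → y ∈ xs ∷ʳ x → y ∈ xs ⊎ y ≡ x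
∈-∷ʳ⁻ xs y∈ with ∈-++⁻ xs y∈
... | inj₁ y∈xs = inj₁ y∈xs
... | inj₂ (here y≡x) = inj₂ y≡x

count : ∀ {A : Set} {P : A → Set} → (∀ x → Dec (P x)) → List A → ℕ
count P? [] = 0
count P? (x ∷ xs) with P? x
... | yes _ = suc (count P? xs)
... | no _ = count P? xs

count-mono : ∀ {A : Set} {P Q : A → Set} (P? : ∀ x → Dec (P x)) (Q? : ∀ x → Dec (Q x)) →
  (∀ {x} → P x → Q x) → ∀ xs → count P? xs ≤ count Q? xs
count-mono P? Q? P⇒Q [] = z≤n
count-mono P? Q? P⇒Q (x ∷ xs) with P? x | Q? x
... | yes _ | yes _ = s≤s (count-mono P? Q? P⇒Q xs)
... | yes p | no ¬q = ⊥-elim (¬q (P⇒Q p))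
... | no _ | yes _ = ℕ.m≤n⇒m≤1+n (count-mono P? Q? P⇒Q xs)
... | no _ | no _ = count-mono P? Q? P⇒Q xs

count-< : ∀ {A : Set} {P Q : A → Set} (P? : ∀ x → Dec (P x)) (Q? : ∀ x → Dec (Q x)) →
  (∀ {x} → P x → Q x) → ∀ {y} xs → y ∈ xs → Q y → ¬ P y → count P? xs < count Q? xs
count-< P? Q? P⇒Q (x ∷ xs) (here refl) q ¬p with P? x | Q? x
... | yes p | _ = ⊥-elim (¬p p)
... | no _ | yes _ = s≤s (count-mono P? Q? P⇒Q xs)
... | no _ | no ¬q = ⊥-elim (¬q q)
count-< P? Q? P⇒Q (x ∷ xs) (there y∈) q ¬p with P? x | Q? x
... | yes _ | yes _ = s≤s (count-< P? Q? P⇒Q xs y∈ q ¬p)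
... | yes p | no ¬q = ⊥-elim (¬q (P⇒Q p))
... | no _ | yes _ = ℕ.m≤n⇒m≤1+n (count-< P? Q? P⇒Q xs y∈ q ¬p)
... | no _ | no _ = count-< P? Q? P⇒Q xs y∈ q ¬p

module Missing {A : Set} (_≟_ : DecidableEquality A) where
  open DecMembership _≟_ using (_∈?_)

  missing : List A → List A → ℕ
  missing U xs = count (λ x → ¬? (x ∈? xs)) U

  missing-mono : ∀ U {xs ys} → xs ⊆ ys → missing U ys ≤ missing U xs
  missing-mono U xs⊆ys = count-mono _ _ (λ x∉ys x∈xs → x∉ys (xs⊆ys x∈xs)) U

  missing-< : ∀ U {xs ys x} → xs ⊆ ys → x ∈ U → x ∉ xs → x ∈ ys → missing U ys < missing U xs
  missing-< U xs⊆ys x∈U x∉xs x∈ys =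
    count-< _ _ (λ y∉ys y∈xs → y∉ys (xs⊆ys y∈xs)) U x∈U x∉xs (λ x∉ys → x∉ys x∈ys)

lookupCtx⇒∈ : ∀ Γ i {A} → lookupCtx Γ i ≡ just A → A ∈ Γ
lookupCtx⇒∈ (B ∷ Γ) zero refl = here refl
lookupCtx⇒∈ (B ∷ Γ) (suc i) eq = there (lookupCtx⇒∈ Γ i eq)

∈⇒lookupCtx : ∀ {Γ A} → A ∈ Γ → ∃ λ i → lookupCtx Γ i ≡ just A
∈⇒lookupCtx (here refl) = zero , refl
∈⇒lookupCtx (there A∈) with ∈⇒lookupCtx A∈
... | i , eq = suc i , eq

∷ʳ-⊆ : ∀ {A : Set} {xs ys : List A} {x} → xs ⊆ ys → x ∈ ys → xs ∷ʳ x ⊆ ys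
∷ʳ-⊆ {xs = xs} xs⊆ys x∈ys y∈ with ∈-∷ʳ⁻ xs y∈
... | inj₁ y∈xs = xs⊆ys y∈xs
... | inj₂ refl = x∈ys

SameFormulas : Context → Context → Set
SameFormulas Γ Γ' = ∀ A → (A ∈ Γ → A ∈ Γ') × (A ∈ Γ' → A ∈ Γ)

SameFormulas-∷ʳ : ∀ {Γ Γ'} A → SameFormulas Γ Γ' → SameFormulas (Γ ∷ʳ A) (Γ' ∷ʳ A)
SameFormulas-∷ʳ {Γ} {Γ'} A same B = extend Γ Γ' (proj₁ (same B)) , extend Γ' Γ (proj₂ (same B))
  where
  extend : ∀ Δ Δ' → (B ∈ Δ → B ∈ Δ') → B ∈ Δ ∷ʳ A → B ∈ Δ' ∷ʳ A
  extend Δ Δ' f B∈ with ∈-∷ʳ⁻ Δ B∈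
  ... | inj₁ B∈Δ = ∈-++⁺ˡ (f B∈Δ)
  ... | inj₂ refl = ∈-++⁺ʳ Δ' (here refl)

≤C-∷ʳ : ∀ {Γ Γ' A} → A ∈ Γ' → Γ ≤C Γ' → Γ ≤C (Γ' ∷ʳ A)
≤C-∷ʳ {Γ} {A = A} A∈Γ' ((Δ , refl) , same) =
  (Δ ∷ʳ A , List.++-assoc Γ Δ (A ∷ [])) , λ B → ∈-++⁺ˡ ∘ proj₁ (same B) , back B
  where
  back : ∀ B → B ∈ (Γ ++ Δ) ∷ʳ A → B ∈ Γ
  back B B∈ with ∈-∷ʳ⁻ (Γ ++ Δ) B∈
  ... | inj₁ B∈Γ' = proj₂ (same B) B∈Γ'
  ... | inj₂ refl = proj₂ (same B) A∈Γ'

-- Bisimilarity and its depth-m approximations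

UniqueHeads : {T : Set} → NodeF T → Set
UniqueHeads (lamF _ _) = ⊤
UniqueHeads (sumF Fs) = ∀ {f f'} → f ∈ Fs → f' ∈ Fs → proj₁ f ≡ proj₁ f' → f ≡ f'

module _ {S T : Set} where

  NodeRel-map : {R R' : S → T → Set} → (∀ {s t} → R s t → R' s t) →
    ∀ {n n'} → NodeRel R n n' → NodeRel R' n n'
  NodeRel-map f (lam≈ r) = lam≈ (f r)
  NodeRel-map f (sum≈ fw bw) = sum≈ (Any.map elim ∘ fw) (Any.map elim ∘ bw)
    where
    elim : ∀ {e g} → ElimRel _ e g → ElimRel _ e g
    elim (x≡y , rs) = x≡y , Pointwise.map f rs

  NodeRel-sym : {R : S → T → Set} → ∀ {n n'} → NodeRel R n n' → NodeRel (λ t s → R s t) n' n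
  NodeRel-sym (lam≈ r) = lam≈ r
  NodeRel-sym (sum≈ fw bw) = sum≈ (Any.map elim ∘ bw) (Any.map elim ∘ fw)
    where
    elim : ∀ {e g} → ElimRel _ e g → ElimRel _ g e
    elim (x≡y , rs) = sym x≡y , Pointwise.symmetric (λ r → r) rs

  -- Sums are compared as sets: without unique heads the witnesses chosen at
  -- different depths could be different alternatives.
  NodeRel-∀ : {R : ℕ → S → T → Set} {n : NodeF S} {n' : NodeF T} → UniqueHeads n' →
    (∀ m → NodeRel (R m) n n') → NodeRel (λ s t → ∀ m → R m s t) n n'
  NodeRel-∀ {n = lamF _ _} {lamF _ _} _ h with h 0
  ... | lam≈ _ = lam≈ (λ m → body (h m))
    where
    body : ∀ {R : S → T → Set} {A s t} → NodeRel R (lamF A s) (lamF A t) → R s t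
    body (lam≈ r) = r
  NodeRel-∀ {n = lamF _ _} {sumF _} _ h with h 0
  ... | ()
  NodeRel-∀ {n = sumF _} {lamF _ _} _ h with h 0
  ... | ()
  NodeRel-∀ {R = R} {sumF Es} {sumF Fs} unique h = sum≈ fwd bwd
    where
    fw : ∀ m {e} → e ∈ Es → Any (ElimRel (R m) e) Fs
    fw m with h m
    ... | sum≈ fw _ = fw
    bw : ∀ m {f} → f ∈ Fs → Any (λ e → ElimRel (R m) e f) Es
    bw m with h m
    ... | sum≈ _ bw = bw
    atAllDepths : ∀ {e f} → e ∈ Es → f ∈ Fs → proj₁ e ≡ proj₁ f → ∀ m → ElimRel (R m) e f
    atAllDepths e∈ f∈ x≡y m with find (fw m e∈)
    ... | f' , f'∈ , (x≡y' , rs) with unique f'∈ f∈ (trans (sym x≡y') x≡y)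
    ... | refl = x≡y' , rs
    merge : ∀ {e f} → (∀ m → ElimRel (R m) e f) → ElimRel (λ s t → ∀ m → R m s t) e f
    merge k = proj₁ (k 0) , Pointwise-∀ (λ m → proj₂ (k m))
    fwd : ∀ {e} → e ∈ Es → Any (ElimRel (λ s t → ∀ m → R m s t) e) Fs
    fwd e∈ with find (fw 0 e∈)
    ... | f , f∈ , (x≡y , _) = lose f∈ (merge (atAllDepths e∈ f∈ x≡y))
    bwd : ∀ {f} → f ∈ Fs → Any (λ e → ElimRel (λ s t → ∀ m → R m s t) e f) Es
    bwd f∈ with find (bw 0 f∈)
    ... | e , e∈ , (x≡y , _) = lose e∈ (merge (atAllDepths e∈ f∈ x≡y))

NodeRel-refl : ∀ {S : Set} (n : NodeF S) → NodeRel _≡_ n n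
NodeRel-refl (lamF A s) = lam≈ refl
NodeRel-refl (sumF Es) = sum≈ (λ e∈ → lose e∈ self) (λ e∈ → lose e∈ self)
  where
  self : ∀ {e} → ElimRel _≡_ e e
  self = refl , Pointwise.refl refl

NodeRel-trans : ∀ {S T U : Set} {R : S → T → Set} {R' : T → U → Set} {R'' : S → U → Set} →
  (∀ {s t u} → R s t → R' t u → R'' s u) →
  ∀ {n n' n''} → NodeRel R n n' → NodeRel R' n' n'' → NodeRel R'' n n''
NodeRel-trans f (lam≈ r) (lam≈ r') = lam≈ (f r r')
NodeRel-trans {R = R} {R'} {R''} f (sum≈ {Es} {Fs} fw bw) (sum≈ {_} {Gs} fw' bw') = sum≈ fwd bwd
  where
  elim : ∀ {e g h} → ElimRel R e g → ElimRel R' g h → ElimRel R'' e h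
  elim (x≡y , rs) (y≡z , rs') = trans x≡y y≡z , Pointwise.transitive f rs rs'
  fwd : ∀ {e} → e ∈ Es → Any (ElimRel R'' e) Gs
  fwd e∈ with find (fw e∈)
  ... | g , g∈ , r = Any.map (elim r) (fw' g∈)
  bwd : ∀ {h} → h ∈ Gs → Any (λ e → ElimRel R'' e h) Es
  bwd h∈ with find (bw' h∈)
  ... | g , g∈ , r = Any.map (λ r' → elim r' r) (bw g∈)

≈-refl : (F : Forest) → F ≈ F
≈-refl F = _≡_ , (λ { s .s refl → NodeRel-refl (nx F s) }) , refl

≈-sym : ∀ {F G} → F ≈ G → G ≈ F
≈-sym (R , bisim , r) = (λ t s → R s t) , (λ t s r' → NodeRel-sym (bisim s t r')) , r

Approx : ∀ {S T : Set} → ℕ → (S → NodeF S) → (T → NodeF T) → S → T → Set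
Approx zero f g s t = ⊤
Approx (suc m) f g s t = NodeRel (Approx m f g) (f s) (g t)

Approx-refl : ∀ m {S : Set} (f : S → NodeF S) s → Approx m f f s s
Approx-refl zero f s = tt
Approx-refl (suc m) f s = NodeRel-map (λ { refl → Approx-refl m f _ }) (NodeRel-refl (f s))

Approx-pred : ∀ m {S T : Set} {f : S → NodeF S} {g : T → NodeF T} {s t} →
  Approx (suc m) f g s t → Approx m f g s t
Approx-pred zero a = tt
Approx-pred (suc m) a = NodeRel-map (Approx-pred m) a

Approx-≈ : ∀ m {F G : Forest} {T : Set} {g : T → NodeF T} {t} →
  F ≈ G → Approx m (nx G) g (root G) t → Approx m (nx F) g (root F) t
Approx-≈ m {F} {G} {g = g} (R , bisim , r) = go m r
  where
  go : ∀ m {s s' t} → R s s' → Approx m (nx G) g s' t → Approx m (nx F) g s t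
  go zero r a = tt
  go (suc m) r a = NodeRel-trans (go m) (bisim _ _ r) a

Approx𝒮 : ℕ → Forest → Context × Formula → Set
Approx𝒮 m F q = Approx m (nx F) 𝒮step (root F) q

-- Solution spaces and co-contraction

premises : Context → Formula → List (Context × Formula)
premises Γ B = map (λ Bj → (Γ , Bj)) (args B)

∈-alts⁻ : ∀ Γ p i Δ {e} → e ∈ alts Γ p i Δ →
  ∃₂ λ j B → lookupCtx Δ j ≡ just B × target B ≡ p × e ≡ (i + j , premises Γ B)
∈-alts⁻ Γ p i (B ∷ Δ) e∈ with target B ℕ.≟ p
∈-alts⁻ Γ p i (B ∷ Δ) (here refl) | yes B↝p =
  zero , B , refl , B↝p , cong (_, premises Γ B) (sym (ℕ.+-identityʳ i))
∈-alts⁻ Γ p i (B ∷ Δ) (there e∈) | yes _ with ∈-alts⁻ Γ p (suc i) Δ e∈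
... | j , B' , l , t , refl = suc j , B' , l , t , cong (_, premises Γ B') (sym (ℕ.+-suc i j))
∈-alts⁻ Γ p i (B ∷ Δ) e∈ | no _ with ∈-alts⁻ Γ p (suc i) Δ e∈
... | j , B' , l , t , refl = suc j , B' , l , t , cong (_, premises Γ B') (sym (ℕ.+-suc i j))

∈-alts⁺ : ∀ Γ p i Δ j {B} → lookupCtx Δ j ≡ just B → target B ≡ p →
  (i + j , premises Γ B) ∈ alts Γ p i Δ
∈-alts⁺ Γ p i (B ∷ Δ) zero refl B↝p with target B ℕ.≟ p
... | yes _ = here (cong (_, premises Γ B) (ℕ.+-identityʳ i))
... | no B↝̸p = ⊥-elim (B↝̸p B↝p)
∈-alts⁺ Γ p i (B ∷ Δ) (suc j) l B'↝p with ∈-alts⁺ Γ p (suc i) Δ j l B'↝p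
... | e∈ rewrite ℕ.+-suc i j with target B ℕ.≟ p
... | yes _ = there e∈
... | no _ = e∈

alts-heads-unique : ∀ Γ p → UniqueHeads (𝒮step (Γ , atom p))
alts-heads-unique Γ p e∈ e'∈ x≡x' with ∈-alts⁻ Γ p 0 Γ e∈ | ∈-alts⁻ Γ p 0 Γ e'∈
... | j , B , l , _ , refl | j' , B' , l' , _ , refl with x≡x'
... | refl with trans (sym l) l'
... | refl = refl

∈-varsWith⁻ : ∀ A i Γ {w} → w ∈ varsWith A i Γ → ∃ λ k → w ≡ i + k × lookupCtx Γ k ≡ just A
∈-varsWith⁻ A i (B ∷ Γ) w∈ with A ≟F B
∈-varsWith⁻ A i (B ∷ Γ) (here refl) | yes refl = zero , sym (ℕ.+-identityʳ i) , refl
∈-varsWith⁻ A i (B ∷ Γ) (there w∈) | yes refl with ∈-varsWith⁻ A (suc i) Γ w∈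
... | k , refl , l = suc k , sym (ℕ.+-suc i k) , l
∈-varsWith⁻ A i (B ∷ Γ) w∈ | no _ with ∈-varsWith⁻ A (suc i) Γ w∈
... | k , refl , l = suc k , sym (ℕ.+-suc i k) , l

∈-varsWith⁺ : ∀ A i Γ k → lookupCtx Γ k ≡ just A → i + k ∈ varsWith A i Γ
∈-varsWith⁺ A i (B ∷ Γ) zero refl with A ≟F A
... | yes _ = here (ℕ.+-identityʳ i)
... | no A≢A = ⊥-elim (A≢A refl)
∈-varsWith⁺ A i (B ∷ Γ) (suc k) l with ∈-varsWith⁺ A (suc i) Γ k l
... | w∈ rewrite ℕ.+-suc i k with A ≟F B
... | yes _ = there w∈
... | no _ = w∈

ccHead-declared : ∀ {S : Set} Γ Γ' z (ms : List S) {A} → lookupCtx Γ z ≡ just A →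
  ccHead Γ Γ' z ms ≡ map (λ w → (w , ms)) (varsWith A 0 Γ')
ccHead-declared Γ Γ' z ms l with lookupCtx Γ z
ccHead-declared Γ Γ' z ms refl | just _ = refl

Approx𝒮⇒≈𝒮 : (F : Forest) → ∀ Γ C → (∀ m → Approx𝒮 m F (Γ , C)) → F ≈ 𝒮 Γ C
Approx𝒮⇒≈𝒮 F Γ C approx = (λ s q → ∀ m → Approx m (nx F) 𝒮step s q) , bisim , approx
  where
  unique : ∀ q → UniqueHeads (𝒮step q)
  unique (Δ , atom p) = alts-heads-unique Δ p
  unique (Δ , A ⊃ B) = tt
  bisim : IsBisim F (𝒮 Γ C) (λ s q → ∀ m → Approx m (nx F) 𝒮step s q)
  bisim s q a = NodeRel-∀ (unique q) (λ m → a (suc m))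

module CoContraction {S : Set} (nxG : S → NodeF S)
  {R : S → Context × Formula → Set} {R' : S × Context × Context → Context × Formula → Set}
  (transfer : ∀ {s Γ Γ' C} → SameFormulas Γ Γ' → R s (Γ , C) → R' (s , Γ , Γ') (Γ' , C)) where

  module _ {Γ Γ' : Context} (same : SameFormulas Γ Γ') where

    tag : S → S × Context × Context
    tag s = s , Γ , Γ'

    ccAlts : List (ℕ × List S) → List (ℕ × List (S × Context × Context))
    ccAlts = concatMap (λ e → ccHead Γ Γ' (proj₁ e) (map tag (proj₂ e)))

    transfer-premises : ∀ ss Bs → Pointwise R ss (map (λ B → (Γ , B)) Bs) →
      Pointwise R' (map tag ss) (map (λ B → (Γ' , B)) Bs)
    transfer-premises [] [] [] = []
    transfer-premises (s ∷ ss) (B ∷ Bs) (r ∷ rs) = transfer same r ∷ transfer-premises ss Bs rs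

    ccAlts⇒alts : ∀ {p Es x} → (∀ {e} → e ∈ Es → Any (ElimRel R e) (alts Γ p 0 Γ)) →
      x ∈ ccAlts Es → Any (ElimRel R' x) (alts Γ' p 0 Γ')
    ccAlts⇒alts {p} {Es} {x} fw x∈ with find (∈-concatMap⁻ _ {xs = Es} x∈)
    ... | (z , ss) , e∈ , x∈head with find (fw e∈)
    ... | f , f∈ , (refl , rs) with ∈-alts⁻ Γ p 0 Γ f∈
    ... | j , B , l , B↝p , refl
      with ∈-map⁻ _ (subst (x ∈_) (ccHead-declared Γ Γ' j (map tag ss) l) x∈head)
    ... | w , w∈ , refl with ∈-varsWith⁻ B 0 Γ' w∈
    ... | k , refl , l' =
      lose (∈-alts⁺ Γ' p 0 Γ' k l' B↝p) (refl , transfer-premises ss (args B) rs)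

    -- The inclusion |Γ'| ⊆ |Γ| provides a variable of Γ declared with B
    alts⇒ccAlts : ∀ {p Es f'} → (∀ {f} → f ∈ alts Γ p 0 Γ → Any (λ e → ElimRel R e f) Es) →
      f' ∈ alts Γ' p 0 Γ' → Any (λ x → ElimRel R' x f') (ccAlts Es)
    alts⇒ccAlts {p} {Es} bw f'∈ with ∈-alts⁻ Γ' p 0 Γ' f'∈
    ... | w , B , l' , B↝p , refl with ∈⇒lookupCtx (proj₂ (same B) (lookupCtx⇒∈ Γ' w l'))
    ... | j , l with find (bw (∈-alts⁺ Γ p 0 Γ j l B↝p))
    ... | (z , ss) , e∈ , (refl , rs) =
      lose (∈-concatMap⁺ _ {xs = Es} (lose e∈ x∈head)) (refl , transfer-premises ss (args B) rs)
      where
      x∈head : (w , map tag ss) ∈ ccHead Γ Γ' j (map tag ss)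
      x∈head = subst ((w , map tag ss) ∈_) (sym (ccHead-declared Γ Γ' j (map tag ss) l))
                     (∈-map⁺ _ (∈-varsWith⁺ B 0 Γ' w l'))

  ccStep-𝒮step : ∀ {s Γ Γ'} C → SameFormulas Γ Γ' →
    NodeRel R (nxG s) (𝒮step (Γ , C)) → NodeRel R' (ccStep nxG (s , Γ , Γ')) (𝒮step (Γ' , C))
  ccStep-𝒮step {s} (A ⊃ B) same h with nxG s | h
  ... | lamF _ _ | lam≈ r = lam≈ (transfer (SameFormulas-∷ʳ A same) r)
  ccStep-𝒮step {s} (atom p) same h with nxG s | h
  ... | sumF Es | sum≈ fw bw = sum≈ (ccAlts⇒alts same fw) (alts⇒ccAlts same bw)

cc-Approx : ∀ m {S : Set} (nxG : S → NodeF S) {s Γ Γ' C} → SameFormulas Γ Γ' →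
  Approx m nxG 𝒮step s (Γ , C) → Approx m (ccStep nxG) 𝒮step (s , Γ , Γ') (Γ' , C)
cc-Approx zero nxG same a = tt
cc-Approx (suc m) nxG {C = C} same a = CoContraction.ccStep-𝒮step nxG (cc-Approx m nxG) C same a

𝒮≈cc𝒮 : ∀ Γ Γ' C → SameFormulas Γ Γ' → 𝒮 Γ' C ≈ cc Γ Γ' (𝒮 Γ C)
𝒮≈cc𝒮 Γ Γ' C same =
  ≈-sym (Approx𝒮⇒≈𝒮 (cc Γ Γ' (𝒮 Γ C)) Γ' C
           (λ m → cc-Approx m 𝒮step same (Approx-refl m 𝒮step (Γ , C))))

-- Finitary terms for solution spaces

-- Canon V Γ C M: M is the term built for Γ ⇒ C below the fixpoints V, where
-- (q , Γq) ∈ V is a gfp annotated with Γq ⇒ q; fixpoint variables are named by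
-- their atom.
Stack : Set
Stack = List (ℕ × Context)

boundAtoms : Stack → List ℕ
boundAtoms = map proj₁

mutual
  data Canon (V : Stack) : Context → Formula → Tm → Set where
    c-lam : ∀ {Γ A B M} → Canon V (Γ ∷ʳ A) B M → Canon V Γ (A ⊃ B) (lamT A M)
    -- Once A ∉ Γ, no enclosing fixpoint can be reused: its context is not ≤ Γ ∷ʳ A
    c-lam-reset : ∀ {Γ A B M} → Canon [] (Γ ∷ʳ A) B M → Canon V Γ (A ⊃ B) (lamT A M)
    c-var : ∀ {Γ Γq p} → (p , Γq) ∈ V → Γq ≤C Γ → Canon V Γ (atom p) (fvar p (Γ ⇒ p))
    c-gfp : ∀ {Γ p Es} → p ∉ boundAtoms V → CanonAlts ((p , Γ) ∷ V) (alts Γ p 0 Γ) Es →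
            Canon V Γ (atom p) (gfp p (Γ ⇒ p) Es)

  data CanonAlts (V : Stack) : List (ℕ × List (Context × Formula)) → List ElimT → Set where
    [] : CanonAlts V [] []
    _∷_ : ∀ {i qs Ns as Es} → CanonArgs V qs Ns → CanonAlts V as Es →
          CanonAlts V ((i , qs) ∷ as) (appT i Ns ∷ Es)

  data CanonArgs (V : Stack) : List (Context × Formula) → List Tm → Set where
    [] : CanonArgs V [] []
    _∷_ : ∀ {Δ B N qs Ns} → Canon V Δ B N → CanonArgs V qs Ns →
          CanonArgs V ((Δ , B) ∷ qs) (N ∷ Ns)

mutual
  Canon-closed : ∀ {V Γ C M Xs} → Canon V Γ C M → boundAtoms V ⊆ Xs → ClosedIn Xs M
  Canon-closed (c-lam c) V⊆Xs = lamC (Canon-closed c V⊆Xs)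
  Canon-closed (c-lam-reset c) V⊆Xs = lamC (Canon-closed c (λ ()))
  Canon-closed (c-var p∈V _) V⊆Xs = varC (V⊆Xs (∈-map⁺ proj₁ p∈V))
  Canon-closed (c-gfp _ cs) V⊆Xs = gfpC (CanonAlts-closed cs extend)
    where
    extend : ∀ {q} → q ∈ _ ∷ boundAtoms _ → q ∈ _ ∷ _
    extend (here q≡p) = here q≡p
    extend (there q∈) = there (V⊆Xs q∈)

  CanonAlts-closed : ∀ {V as Es Xs} → CanonAlts V as Es → boundAtoms V ⊆ Xs → All (ClosedInE Xs) Es
  CanonAlts-closed [] V⊆Xs = []
  CanonAlts-closed (cs ∷ css) V⊆Xs = appC (CanonArgs-closed cs V⊆Xs) ∷ CanonAlts-closed css V⊆Xs

  CanonArgs-closed : ∀ {V qs Ns Xs} → CanonArgs V qs Ns → boundAtoms V ⊆ Xs → All (ClosedIn Xs) Ns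
  CanonArgs-closed [] V⊆Xs = []
  CanonArgs-closed (c ∷ cs) V⊆Xs = Canon-closed c V⊆Xs ∷ CanonArgs-closed cs V⊆Xs

lookupEnv-here : ∀ X σ F ξ → lookupEnv ((X , σ , F) ∷ ξ) X ≡ just (σ , F)
lookupEnv-here X σ F ξ with X ℕ.≟ X
... | yes _ = refl
... | no X≢X = ⊥-elim (X≢X refl)

lookupEnv-there : ∀ X σ F ξ {Y} → Y ≢ X → lookupEnv ((X , σ , F) ∷ ξ) Y ≡ lookupEnv ξ Y
lookupEnv-there X σ F ξ {Y} Y≢X with Y ℕ.≟ X
... | yes Y≡X = ⊥-elim (Y≢X Y≡X)
... | no _ = refl

∉-boundAtoms : ∀ {V p q Γq} → p ∉ boundAtoms V → (q , Γq) ∈ V → q ≢ p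
∉-boundAtoms p∉V q∈V refl = p∉V (∈-map⁺ proj₁ q∈V)

𝒮Alts : List (ℕ × List (Context × Formula)) → List (ℕ × List Forest)
𝒮Alts = map (λ e → (proj₁ e , map (uncurry 𝒮) (proj₂ e)))

𝒮-unfold-atom : ∀ Γ p → 𝒮 Γ (atom p) ≈node sum (𝒮Alts (alts Γ p 0 Γ))
𝒮-unfold-atom Γ p =
  alts Γ p 0 Γ , refl ,
  (λ {e} e∈ → lose (∈-map⁺ _ e∈) (refl , subforests (proj₂ e))) ,
  bwd
  where
  subforests : ∀ qs → Pointwise (λ q G → at (𝒮 Γ (atom p)) q ≈ G) qs (map (uncurry 𝒮) qs)
  subforests [] = []
  subforests (q ∷ qs) = ≈-refl _ ∷ subforests qs
  bwd : ∀ {g} → g ∈ 𝒮Alts (alts Γ p 0 Γ) → Any (λ e → proj₁ e ≡ proj₁ g ×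
          Pointwise (λ q G → at (𝒮 Γ (atom p)) q ≈ G) (proj₂ e) (proj₂ g)) (alts Γ p 0 Γ)
  bwd g∈ with ∈-map⁻ _ g∈
  ... | e , e∈ , refl = lose e∈ (refl , subforests (proj₂ e))

SolutionEnv : Env → Stack → Set₁
SolutionEnv ξ V = ∀ {q Γq} → (q , Γq) ∈ V → lookupEnv ξ q ≡ just ((Γq ⇒ q) , 𝒮 Γq (atom q))

mutual
  Canon-interp : ∀ {V Γ C M ξ} → Canon V Γ C M → SolutionEnv ξ V → Interp ξ M (𝒮 Γ C)
  Canon-interp {Γ = Γ} {A ⊃ B} (c-lam c) env =
    lam-i (Canon-interp c env) ((Γ ∷ʳ A , B) , refl , ≈-refl _)
  Canon-interp {Γ = Γ} {A ⊃ B} (c-lam-reset c) env =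
    lam-i (Canon-interp c (λ ())) ((Γ ∷ʳ A , B) , refl , ≈-refl _)
  Canon-interp {Γ = Γ} {atom p} (c-var {Γq = Γq} p∈V Γq≤Γ) env =
    var-bound (env p∈V) (Γq≤Γ , refl) (𝒮≈cc𝒮 Γq Γ (atom p) (proj₂ Γq≤Γ))
  Canon-interp {V} {Γ} {atom p} {ξ = ξ} (c-gfp p∉V cs) env =
    gfp-i (𝒮Alts (alts Γ p 0 Γ)) (CanonAlts-interp cs env') (𝒮-unfold-atom Γ p)
    where
    env' : SolutionEnv ((p , (Γ ⇒ p) , 𝒮 Γ (atom p)) ∷ ξ) ((p , Γ) ∷ V)
    env' (here refl) = lookupEnv-here p _ _ ξ
    env' (there q∈V) = trans (lookupEnv-there p _ _ ξ (∉-boundAtoms p∉V q∈V)) (env q∈V)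

  CanonAlts-interp : ∀ {V as Es ξ} → CanonAlts V as Es → SolutionEnv ξ V →
    Pointwise (InterpE ξ) Es (𝒮Alts as)
  CanonAlts-interp [] env = []
  CanonAlts-interp (cs ∷ css) env = app-i (CanonArgs-interp cs env) ∷ CanonAlts-interp css env

  CanonArgs-interp : ∀ {V qs Ns ξ} → CanonArgs V qs Ns → SolutionEnv ξ V →
    Pointwise (Interp ξ) Ns (map (uncurry 𝒮) qs)
  CanonArgs-interp [] env = []
  CanonArgs-interp (c ∷ cs) env = Canon-interp c env ∷ CanonArgs-interp cs env

ApproxEnv : ℕ → Env → Stack → Set₁
ApproxEnv m ξ V = ∀ {q Γq} → (q , Γq) ∈ V →
  ∃ λ G → lookupEnv ξ q ≡ just ((Γq ⇒ q) , G) × Approx𝒮 m G (Γq , atom q)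

ApproxEnv-pred : ∀ m {ξ V} → ApproxEnv (suc m) ξ V → ApproxEnv m ξ V
ApproxEnv-pred m env q∈V = let G , l , a = env q∈V in G , l , Approx-pred m a

ApproxAlt : ℕ → ℕ × List (Context × Formula) → ℕ × List Forest → Set₁
ApproxAlt m e g = proj₁ e ≡ proj₁ g × Pointwise (λ q G → Approx𝒮 m G q) (proj₂ e) (proj₂ g)

-- Guardedness: each unfolding of a gfp produces a sum of eliminations, so
-- depth m + 1 of a fixpoint only needs depth m of its own variable
mutual
  Canon-Approx : ∀ m {V Γ C M ξ} → Canon V Γ C M → ApproxEnv m ξ V →
    ∀ {H} → Interp ξ M H → Approx𝒮 m H (Γ , C)
  Canon-Approx zero c env d = tt
  Canon-Approx (suc m) {V} {ξ = ξ} (c-lam c) env (lam-i d (_ , eq , H≈)) rewrite eq =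
    lam≈ (Approx-≈ m H≈ (Canon-Approx m c (ApproxEnv-pred m {ξ} {V} env) d))
  Canon-Approx (suc m) (c-lam-reset c) env (lam-i d (_ , eq , H≈)) rewrite eq =
    lam≈ (Approx-≈ m H≈ (Canon-Approx m c (λ ()) d))
  Canon-Approx m (c-var p∈V Γq≤Γ) env (var-bound l _ H≈) with env p∈V
  ... | G , l' , a with trans (sym l) l'
  ... | refl = Approx-≈ m H≈ (cc-Approx m (nx G) (proj₂ Γq≤Γ) a)
  Canon-Approx m (c-var p∈V Γq≤Γ) env (var-default unbound _) with env p∈V
  ... | G , l' , _ = ⊥-elim (unbound _ _ l' (Γq≤Γ , refl))
  Canon-Approx (suc m) {V} {Γ} {atom p} {ξ = ξ} (c-gfp p∉V cs) env {H}
               d@(gfp-i Fs ds (EsH , eq , fw , bw)) rewrite eq = sum≈ fwd bwd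
    where
    env' : ApproxEnv m ((p , (Γ ⇒ p) , H) ∷ ξ) ((p , Γ) ∷ V)
    env' (here refl) =
      H , lookupEnv-here p _ _ ξ , Canon-Approx m (c-gfp p∉V cs) (ApproxEnv-pred m {ξ} {V} env) d
    env' (there q∈V) = let G , l , a = ApproxEnv-pred m {ξ} {V} env q∈V in
      G , trans (lookupEnv-there p _ _ ξ (∉-boundAtoms p∉V q∈V)) l , a
    alts≈Fs : Pointwise (ApproxAlt m) (alts Γ p 0 Γ) Fs
    alts≈Fs = CanonAlts-Approx m cs env' ds
    approxArgs : ∀ {ss Gs qs} → Pointwise (λ s G → at H s ≈ G) ss Gs →
      Pointwise (λ q G → Approx𝒮 m G q) qs Gs → Pointwise (Approx m (nx H) 𝒮step) ss qs
    approxArgs H≈ a = Pointwise.transitive (Approx-≈ m) H≈ (Pointwise.symmetric (λ r → r) a)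
    fwd : ∀ {e} → e ∈ EsH → Any (ElimRel (Approx m (nx H) 𝒮step) e) (alts Γ p 0 Γ)
    fwd e∈ with find (fw e∈)
    ... | g , g∈ , (x≡ , H≈) with Pointwise-∈ʳ alts≈Fs g∈
    ... | a , a∈ , (y≡ , a≈) = lose a∈ (trans x≡ (sym y≡) , approxArgs H≈ a≈)
    bwd : ∀ {a} → a ∈ alts Γ p 0 Γ → Any (λ e → ElimRel (Approx m (nx H) 𝒮step) e a) EsH
    bwd a∈ with Pointwise-∈ˡ alts≈Fs a∈
    ... | g , g∈ , (y≡ , a≈) with find (bw g∈)
    ... | e , e∈ , (x≡ , H≈) = lose e∈ (trans x≡ (sym y≡) , approxArgs H≈ a≈)

  CanonAlts-Approx : ∀ m {V as Es ξ Fs} → CanonAlts V as Es → ApproxEnv m ξ V →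
    Pointwise (InterpE ξ) Es Fs → Pointwise (ApproxAlt m) as Fs
  CanonAlts-Approx m [] env [] = []
  CanonAlts-Approx m (cs ∷ css) env (app-i ds ∷ dss) =
    (refl , CanonArgs-Approx m cs env ds) ∷ CanonAlts-Approx m css env dss

  CanonArgs-Approx : ∀ m {V qs Ns ξ Gs} → CanonArgs V qs Ns → ApproxEnv m ξ V →
    Pointwise (Interp ξ) Ns Gs → Pointwise (λ q G → Approx𝒮 m G q) qs Gs
  CanonArgs-Approx m [] env [] = []
  CanonArgs-Approx m (c ∷ cs) env (d ∷ ds) = Canon-Approx m c env d ∷ CanonArgs-Approx m cs env ds

subformulas : Formula → List Formula
subformulas (atom q) = atom q ∷ []
subformulas (A ⊃ B) = (A ⊃ B) ∷ subformulas A ++ subformulas B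

∈-subformulas : ∀ D → D ∈ subformulas D
∈-subformulas (atom q) = here refl
∈-subformulas (A ⊃ B) = here refl

SubformulaClosed : List Formula → Set
SubformulaClosed U = ∀ {A B} → (A ⊃ B) ∈ U → A ∈ U × B ∈ U

subformulas-closed : ∀ D → SubformulaClosed (subformulas D)
subformulas-closed (atom q) (here ())
subformulas-closed (atom q) (there ())
subformulas-closed (A ⊃ B) (here refl) =
  there (∈-++⁺ˡ (∈-subformulas A)) , there (∈-++⁺ʳ (subformulas A) (∈-subformulas B))
subformulas-closed (A ⊃ B) (there A'⊃B'∈) with ∈-++⁻ (subformulas A) A'⊃B'∈
... | inj₁ ∈A = let A'∈ , B'∈ = subformulas-closed A ∈A in there (∈-++⁺ˡ A'∈) , there (∈-++⁺ˡ B'∈)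
... | inj₂ ∈B = let A'∈ , B'∈ = subformulas-closed B ∈B in
  there (∈-++⁺ʳ (subformulas A) A'∈) , there (∈-++⁺ʳ (subformulas A) B'∈)

concatMap-subformulas-closed : ∀ Ds → SubformulaClosed (concatMap subformulas Ds)
concatMap-subformulas-closed Ds A⊃B∈ with find (∈-concatMap⁻ subformulas {xs = Ds} A⊃B∈)
... | D , D∈ , A⊃B∈D = let A∈ , B∈ = subformulas-closed D A⊃B∈D in
  ∈-concatMap⁺ subformulas {xs = Ds} (lose D∈ A∈) , ∈-concatMap⁺ subformulas {xs = Ds} (lose D∈ B∈)

args-⊆ : ∀ {U} → SubformulaClosed U → ∀ B → B ∈ U → args B ⊆ U
args-⊆ closed (A ⊃ B) A⊃B∈ (here refl) = proj₁ (closed A⊃B∈)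
args-⊆ closed (A ⊃ B) A⊃B∈ (there Bj∈) = args-⊆ closed B (proj₂ (closed A⊃B∈)) Bj∈

≤C-refl : ∀ Γ → Γ ≤C Γ
≤C-refl Γ = ([] , sym (List.++-identityʳ Γ)) , λ A → (λ A∈ → A∈) , (λ A∈ → A∈)

∉-map-atom : ∀ {p ns} → p ∉ ns → atom p ∉ map atom ns
∉-map-atom p∉ ap∈ with ∈-map⁻ atom ap∈
... | q , q∈ , refl = p∉ q∈

module Construction (U : List Formula) (U-closed : SubformulaClosed U) where
  open Missing _≟F_
  open DecMembership _≟F_ using (_∈?_)
  open DecMembership ℕ._≟_ using () renaming (_∈?_ to _∈ℕ?_)

  StackBelow : Stack → Context → Set
  StackBelow V Γ = ∀ {q Γq} → (q , Γq) ∈ V → Γq ≤C Γ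

  PremiseIn : Context → Context × Formula → Set
  PremiseIn Γ q = proj₁ q ≡ Γ × proj₂ q ∈ U

  alts-premises : ∀ Γ p → Γ ⊆ U → All (All (PremiseIn Γ) ∘ proj₂) (alts Γ p 0 Γ)
  alts-premises Γ p Γ⊆U = All.tabulate λ e∈ → All.tabulate λ q∈ → premise e∈ q∈
    where
    premise : ∀ {e q} → e ∈ alts Γ p 0 Γ → q ∈ proj₂ e → PremiseIn Γ q
    premise e∈ q∈ with ∈-alts⁻ Γ p 0 Γ e∈
    ... | j , B , l , _ , refl with ∈-map⁻ _ q∈
    ... | Bj , Bj∈ , refl = refl , args-⊆ U-closed B (Γ⊆U (lookupCtx⇒∈ Γ j l)) Bj∈

  -- The fuel (a , b) decreases lexicographically: assuming a new formula consumes
  -- a and resets the stack, hence b; opening a gfp consumes b.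
  mutual
    canon : ∀ a b V Γ C → Γ ⊆ U → C ∈ U → StackBelow V Γ →
      missing U Γ ≤ a → missing U (map atom (boundAtoms V)) ≤ b → ∃ (Canon V Γ C)
    canon a b V Γ (A ⊃ B) Γ⊆U C∈U below ha hb with A ∈? Γ | U-closed C∈U
    ... | yes A∈Γ | A∈U , B∈U =
      let M , c = canon a b V (Γ ∷ʳ A) B (∷ʳ-⊆ Γ⊆U A∈U) B∈U (λ q∈V → ≤C-∷ʳ A∈Γ (below q∈V))
                        (ℕ.≤-trans (missing-mono U ∈-++⁺ˡ) ha) hb
      in lamT A M , c-lam c
    ... | no A∉Γ | A∈U , B∈U with missing-< U ∈-++⁺ˡ A∈U A∉Γ (∈-++⁺ʳ Γ {A ∷ []} (here refl))
    canon zero b V Γ (A ⊃ B) Γ⊆U C∈U below ha hb | no _ | _ | fewer =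
      ⊥-elim (ℕ.n≮0 (ℕ.<-≤-trans fewer ha))
    canon (suc a) b V Γ (A ⊃ B) Γ⊆U C∈U below ha hb | no _ | A∈U , B∈U | fewer =
      let M , c = canon a (missing U []) [] (Γ ∷ʳ A) B (∷ʳ-⊆ Γ⊆U A∈U) B∈U (λ ())
                        (ℕ.≤-pred (ℕ.<-≤-trans fewer ha)) ℕ.≤-refl
      in lamT A M , c-lam-reset c
    canon a b V Γ (atom p) Γ⊆U C∈U below ha hb with p ∈ℕ? boundAtoms V
    ... | yes p∈V with ∈-map⁻ proj₁ p∈V
    ... | (q , Γq) , q∈V , refl = fvar p (Γ ⇒ p) , c-var q∈V (below q∈V)
    canon a b V Γ (atom p) Γ⊆U C∈U below ha hb | no p∉V
      with missing-< U there C∈U (∉-map-atom p∉V) (here refl)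
    canon a zero V Γ (atom p) Γ⊆U C∈U below ha hb | no _ | fewer =
      ⊥-elim (ℕ.n≮0 (ℕ.<-≤-trans fewer hb))
    canon a (suc b) V Γ (atom p) Γ⊆U C∈U below ha hb | no p∉V | fewer =
      let Es , cs = canonAlts a b ((p , Γ) ∷ V) Γ (alts Γ p 0 Γ) Γ⊆U below' (alts-premises Γ p Γ⊆U)
                              ha (ℕ.≤-pred (ℕ.<-≤-trans fewer hb))
      in gfp p (Γ ⇒ p) Es , c-gfp p∉V cs
      where
      below' : StackBelow ((p , Γ) ∷ V) Γ
      below' (here refl) = ≤C-refl Γ
      below' (there q∈V) = below q∈V

    canonAlts : ∀ a b V Γ as → Γ ⊆ U → StackBelow V Γ → All (All (PremiseIn Γ) ∘ proj₂) as →
      missing U Γ ≤ a → missing U (map atom (boundAtoms V)) ≤ b → ∃ (CanonAlts V as)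
    canonAlts a b V Γ [] Γ⊆U below [] ha hb = [] , []
    canonAlts a b V Γ ((i , qs) ∷ as) Γ⊆U below (ps ∷ pss) ha hb =
      let Ns , cs = canonArgs a b V Γ qs Γ⊆U below ps ha hb
          Es , css = canonAlts a b V Γ as Γ⊆U below pss ha hb
      in appT i Ns ∷ Es , cs ∷ css

    canonArgs : ∀ a b V Γ qs → Γ ⊆ U → StackBelow V Γ → All (PremiseIn Γ) qs →
      missing U Γ ≤ a → missing U (map atom (boundAtoms V)) ≤ b → ∃ (CanonArgs V qs)
    canonArgs a b V Γ [] Γ⊆U below [] ha hb = [] , []
    canonArgs a b V Γ ((Γ , B) ∷ qs) Γ⊆U below ((refl , B∈U) ∷ ps) ha hb =
      let N , c = canon a b V Γ B Γ⊆U B∈U below ha hb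
          Ns , cs = canonArgs a b V Γ qs Γ⊆U below ps ha hb
      in N ∷ Ns , c ∷ cs

  canonical : ∀ Γ C → Γ ⊆ U → C ∈ U → ∃ (Canon [] Γ C)
  canonical Γ C Γ⊆U C∈U =
    canon (missing U Γ) (missing U []) [] Γ C Γ⊆U C∈U (λ ()) ℕ.≤-refl ℕ.≤-refl

theorem25 : (Γ : Context) (C : Formula) →
    Σ Tm (λ N → Closed N × (N ⟦⟧≈ 𝒮 Γ C))
theorem25 Γ C =
  let N , c = Construction.canonical U (concatMap-subformulas-closed (C ∷ Γ)) Γ C Γ⊆U C∈U
  in N , Canon-closed c (λ ()) , Canon-interp c (λ ()) ,
     λ F d → Approx𝒮⇒≈𝒮 F Γ C (λ m → Canon-Approx m c (λ ()) d)
  where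
  U : List Formula
  U = concatMap subformulas (C ∷ Γ)
  Γ⊆U : Γ ⊆ U
  Γ⊆U {A} A∈Γ = ∈-concatMap⁺ subformulas {xs = C ∷ Γ} (there (lose A∈Γ (∈-subformulas A)))
  C∈U : C ∈ U
  C∈U = ∈-concatMap⁺ subformulas {xs = C ∷ Γ} (here (∈-subformulas C))
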